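{- Assume ${\sf par}$ is infinite. For all formulas $A,B\in\mathcal{L}$ the following are equivalent: (1) $\vdash A\to B$ (intuitionistically); (2) $A\mathrel{|\!\sim_{\mathcal{L}}} B$; (3) $A\mathrel{|\!\approx_{P}} B$, where $P$ is the set of all ${\sf par}$-projective formulas.
   Context: The language $\mathcal{L}$ is built from atoms ${\sf var}\cup{\sf par}$ (variables and parameters, disjoint infinite sets) using $\bot,\wedge,\vee,\to$; $\mathcal{L}({\sf par})$ is the set of formulas whose atoms are all parameters. A substitution is a map $\theta:\mathcal{L}\to\mathcal{L}$ commuting with connectives and fixing every parameter. $\vdash$ is intuitionistic derivability. A formula $F$ is $E$-projective ($E\in\mathcal{L}({\sf par})$) if there is a substitution $\theta$ with $F\vdash\theta(a)\leftrightarrow a$ for every atom $a$ and $\vdash\theta(F)\leftrightarrow E$; it is ${\sf par}$-projective if it is $E$-projective for some $E\in\mathcal{L}({\sf par})$. For a set of formulas $\Gamma$, $A\mathrel{|\!\sim_{\Gamma}} B$ means: for every $E\in\Gamma\cap\mathcal{L}({\sf par})$ and every substitution $\theta$, if $\vdash E\to\theta(A)$ then $\vdash E\to\theta(B)$. For a set $\Delta$ of formulas, $A\mathrel{|\!\approx_{\Delta}} B$ (preservativity) means: for every $F\in\Delta$, if $\vdash F\to A$ then $\vdash F\to B$. -}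

module Defs where

open import Data.Nat using (ℕ)
open import Data.List using (List; []; _∷_)
open import Data.List.Membership.Propositional using (_∈_)
open import Data.Product using (Σ; _×_; _,_)

data Atom : Set where
  var : ℕ → Atom
  par : ℕ → Atom

infixr 6 _∧′_
infixr 5 _∨′_
infixr 4 _⇒_
data Fm : Set where
  at   : Atom → Fm
  ⊥′   : Fm
  _∧′_ : Fm → Fm → Fm
  _∨′_ : Fm → Fm → Fm
  _⇒_  : Fm → Fm → Fm

_⇔′_ : Fm → Fm → Fm
A ⇔′ B = (A ⇒ B) ∧′ (B ⇒ A)

data ParFm : Fm → Set where
  par-at : ∀ n → ParFm (at (par n))
  par-⊥  : ParFm ⊥′
  par-∧  : ∀ {A B} → ParFm A → ParFm B → ParFm (A ∧′ B)
  par-∨  : ∀ {A B} → ParFm A → ParFm B → ParFm (A ∨′ B)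
  par-⇒  : ∀ {A B} → ParFm A → ParFm B → ParFm (A ⇒ B)

-- A substitution commutes with connectives and fixes every parameter, so it is
-- determined by its values on variables.
Subst : Set
Subst = ℕ → Fm

sub : Subst → Fm → Fm
sub θ (at (var n)) = θ n
sub θ (at (par n)) = at (par n)
sub θ ⊥′ = ⊥′
sub θ (A ∧′ B) = sub θ A ∧′ sub θ B
sub θ (A ∨′ B) = sub θ A ∨′ sub θ B
sub θ (A ⇒ B) = sub θ A ⇒ sub θ B

infix 2 _⊢_
data _⊢_ (Γ : List Fm) : Fm → Set where
  hyp  : ∀ {A} → A ∈ Γ → Γ ⊢ A
  ⊥E   : ∀ {A} → Γ ⊢ ⊥′ → Γ ⊢ A
  ∧I   : ∀ {A B} → Γ ⊢ A → Γ ⊢ B → Γ ⊢ A ∧′ B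
  ∧E₁  : ∀ {A B} → Γ ⊢ A ∧′ B → Γ ⊢ A
  ∧E₂  : ∀ {A B} → Γ ⊢ A ∧′ B → Γ ⊢ B
  ∨I₁  : ∀ {A B} → Γ ⊢ A → Γ ⊢ A ∨′ B
  ∨I₂  : ∀ {A B} → Γ ⊢ B → Γ ⊢ A ∨′ B
  ∨E   : ∀ {A B C} → Γ ⊢ A ∨′ B → (A ∷ Γ) ⊢ C → (B ∷ Γ) ⊢ C → Γ ⊢ C
  ⇒I   : ∀ {A B} → (A ∷ Γ) ⊢ B → Γ ⊢ A ⇒ B
  ⇒E   : ∀ {A B} → Γ ⊢ A ⇒ B → Γ ⊢ A → Γ ⊢ B

⊢_ : Fm → Set
⊢ A = [] ⊢ A

IsProjectiveFor : Fm → Fm → Set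
IsProjectiveFor E F =
  Σ Subst λ θ → ((a : Atom) → (F ∷ []) ⊢ (sub θ (at a) ⇔′ at a)) × (⊢ (sub θ F ⇔′ E))

ParProjective : Fm → Set
ParProjective F = Σ Fm λ E → ParFm E × IsProjectiveFor E F

_|~L_ : Fm → Fm → Set
A |~L B = (E : Fm) → ParFm E → (θ : Subst) → ⊢ (E ⇒ sub θ A) → ⊢ (E ⇒ sub θ B)

_|≈P_ : Fm → Fm → Set
A |≈P B = (F : Fm) → ParProjective F → ⊢ (F ⇒ A) → ⊢ (F ⇒ B)

-- Derivability is closed under substitution and cut, which gives (1) ⇒ (2) and
-- (1) ⇒ (3). For the converses pick K above every atom index of A and B and
-- "freeze" the variables x_n (n < K) into the fresh parameters p_{K+n}. The
-- frozen A is a parameter formula E with ⊢ E → θ(A), so (2) yields ⊢ E → θ(B),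
-- and renaming the fresh parameters back into variables recovers ⊢ A → B.
-- For (3), the formula A ∧ ⋀_{n<K} (p_{K+n} ↔ x_n) is par-projective via the
-- same freezing substitution; it implies A, hence B, and thawing turns the
-- conjuncts p_{K+n} ↔ x_n into the tautologies x_n ↔ x_n.
module Submission where

open import Defs
open import Data.Empty using (⊥-elim)
open import Data.List using ([]; _∷_; map)
open import Data.List.Membership.Propositional.Properties using (∈-map⁺)
open import Data.List.Relation.Binary.Subset.Propositional using (_⊆_)
open import Data.List.Relation.Binary.Subset.Propositional.Properties using (∷⁺ʳ)
open import Data.List.Relation.Unary.Any using (here)
open import Data.Nat using (ℕ; zero; suc; _+_; _∸_; _<_; _≤_; _⊔_; _<?_)
open import Data.Nat.Properties
  using (≤-refl; ≤-trans; <-≤-trans; <⇒≱; m≤m+n; m+n∸m≡n; n≤1+n; m≤m⊔n; m≤n⊔m; m<1+n⇒m<n∨m≡n)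
open import Data.Product using (_×_; _,_)
open import Data.Sum using (inj₁; inj₂)
open import Data.Unit using (⊤; tt)
open import Function.Bundles using (_⇔_; mk⇔)
open import Relation.Nullary using (yes; no)
open import Relation.Binary.PropositionalEquality using (_≡_; refl; cong; cong₂; sym; subst)

⊢-weaken : ∀ {Γ Δ C} → Γ ⊆ Δ → Γ ⊢ C → Δ ⊢ C
⊢-weaken Γ⊆Δ (hyp p)     = hyp (Γ⊆Δ p)
⊢-weaken Γ⊆Δ (⊥E d)      = ⊥E (⊢-weaken Γ⊆Δ d)
⊢-weaken Γ⊆Δ (∧I d e)    = ∧I (⊢-weaken Γ⊆Δ d) (⊢-weaken Γ⊆Δ e)
⊢-weaken Γ⊆Δ (∧E₁ d)     = ∧E₁ (⊢-weaken Γ⊆Δ d)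
⊢-weaken Γ⊆Δ (∧E₂ d)     = ∧E₂ (⊢-weaken Γ⊆Δ d)
⊢-weaken Γ⊆Δ (∨I₁ d)     = ∨I₁ (⊢-weaken Γ⊆Δ d)
⊢-weaken Γ⊆Δ (∨I₂ d)     = ∨I₂ (⊢-weaken Γ⊆Δ d)
⊢-weaken Γ⊆Δ (∨E d e f)  = ∨E (⊢-weaken Γ⊆Δ d) (⊢-weaken (∷⁺ʳ _ Γ⊆Δ) e) (⊢-weaken (∷⁺ʳ _ Γ⊆Δ) f)
⊢-weaken Γ⊆Δ (⇒I d)      = ⇒I (⊢-weaken (∷⁺ʳ _ Γ⊆Δ) d)
⊢-weaken Γ⊆Δ (⇒E d e)    = ⇒E (⊢-weaken Γ⊆Δ d) (⊢-weaken Γ⊆Δ e)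

⊢-closed : ∀ {Γ C} → ⊢ C → Γ ⊢ C
⊢-closed = ⊢-weaken (λ ())

⇒-refl : ∀ {Γ} C → Γ ⊢ C ⇒ C
⇒-refl C = ⇒I (hyp (here refl))

⇔-refl : ∀ {Γ} C → Γ ⊢ C ⇔′ C
⇔-refl C = ∧I (⇒-refl C) (⇒-refl C)

⇒-trans : ∀ {A B C} → ⊢ (A ⇒ B) → ⊢ (B ⇒ C) → ⊢ (A ⇒ C)
⇒-trans d e = ⇒I (⇒E (⊢-closed e) (⇒E (⊢-closed d) (hyp (here refl))))

∧-discharge : ∀ {A B C} → ⊢ (A ∧′ C ⇒ B) → ⊢ C → ⊢ (A ⇒ B)
∧-discharge d c = ⇒I (⇒E (⊢-closed d) (∧I (hyp (here refl)) (⊢-closed c)))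

-- Substitutions that may also move parameters; needed to turn fresh
-- parameters back into variables, which no `Subst` can do.
infix 25 _[_]
_[_] : Fm → (Atom → Fm) → Fm
at a     [ σ ] = σ a
⊥′       [ σ ] = ⊥′
(A ∧′ B) [ σ ] = A [ σ ] ∧′ B [ σ ]
(A ∨′ B) [ σ ] = A [ σ ] ∨′ B [ σ ]
(A ⇒ B)  [ σ ] = A [ σ ] ⇒ B [ σ ]

⊢-[] : ∀ σ {Γ C} → Γ ⊢ C → map (_[ σ ]) Γ ⊢ C [ σ ]
⊢-[] σ (hyp p)    = hyp (∈-map⁺ (_[ σ ]) p)
⊢-[] σ (⊥E d)     = ⊥E (⊢-[] σ d)
⊢-[] σ (∧I d e)   = ∧I (⊢-[] σ d) (⊢-[] σ e)
⊢-[] σ (∧E₁ d)    = ∧E₁ (⊢-[] σ d)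
⊢-[] σ (∧E₂ d)    = ∧E₂ (⊢-[] σ d)
⊢-[] σ (∨I₁ d)    = ∨I₁ (⊢-[] σ d)
⊢-[] σ (∨I₂ d)    = ∨I₂ (⊢-[] σ d)
⊢-[] σ (∨E d e f) = ∨E (⊢-[] σ d) (⊢-[] σ e) (⊢-[] σ f)
⊢-[] σ (⇒I d)     = ⇒I (⊢-[] σ d)
⊢-[] σ (⇒E d e)   = ⇒E (⊢-[] σ d) (⊢-[] σ e)

atomSubst : Subst → Atom → Fm
atomSubst θ a = sub θ (at a)

sub≡[atomSubst] : ∀ θ C → sub θ C ≡ C [ atomSubst θ ]
sub≡[atomSubst] θ (at (var n)) = refl
sub≡[atomSubst] θ (at (par n)) = refl
sub≡[atomSubst] θ ⊥′           = refl
sub≡[atomSubst] θ (A ∧′ B)     = cong₂ _∧′_ (sub≡[atomSubst] θ A) (sub≡[atomSubst] θ B)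
sub≡[atomSubst] θ (A ∨′ B)     = cong₂ _∨′_ (sub≡[atomSubst] θ A) (sub≡[atomSubst] θ B)
sub≡[atomSubst] θ (A ⇒ B)      = cong₂ _⇒_ (sub≡[atomSubst] θ A) (sub≡[atomSubst] θ B)

⊢-sub : ∀ θ {C} → ⊢ C → ⊢ sub θ C
⊢-sub θ {C} d = subst ⊢_ (sym (sub≡[atomSubst] θ C)) (⊢-[] (atomSubst θ) d)

⊢-[]-closed : ∀ σ {C D} → ⊢ C → C [ σ ] ≡ D → ⊢ D
⊢-[]-closed σ d eq = subst ⊢_ eq (⊢-[] σ d)

atomIndex : Atom → ℕ
atomIndex (var n) = n
atomIndex (par n) = n

AtomsBelow : ℕ → Fm → Set
AtomsBelow K (at a)   = atomIndex a < K
AtomsBelow K ⊥′       = ⊤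
AtomsBelow K (A ∧′ B) = AtomsBelow K A × AtomsBelow K B
AtomsBelow K (A ∨′ B) = AtomsBelow K A × AtomsBelow K B
AtomsBelow K (A ⇒ B)  = AtomsBelow K A × AtomsBelow K B

atomBound : Fm → ℕ
atomBound (at a)   = suc (atomIndex a)
atomBound ⊥′       = 0
atomBound (A ∧′ B) = atomBound A ⊔ atomBound B
atomBound (A ∨′ B) = atomBound A ⊔ atomBound B
atomBound (A ⇒ B)  = atomBound A ⊔ atomBound B

AtomsBelow-mono : ∀ {K L} A → K ≤ L → AtomsBelow K A → AtomsBelow L A
AtomsBelow-mono (at a)   K≤L a<K       = <-≤-trans a<K K≤L
AtomsBelow-mono ⊥′       K≤L _         = tt
AtomsBelow-mono (A ∧′ B) K≤L (bA , bB) = AtomsBelow-mono A K≤L bA , AtomsBelow-mono B K≤L bB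
AtomsBelow-mono (A ∨′ B) K≤L (bA , bB) = AtomsBelow-mono A K≤L bA , AtomsBelow-mono B K≤L bB
AtomsBelow-mono (A ⇒ B)  K≤L (bA , bB) = AtomsBelow-mono A K≤L bA , AtomsBelow-mono B K≤L bB

AtomsBelow-⊔ˡ : ∀ {K} L A → AtomsBelow K A → AtomsBelow (K ⊔ L) A
AtomsBelow-⊔ˡ L A = AtomsBelow-mono A (m≤m⊔n _ L)

AtomsBelow-⊔ʳ : ∀ K {L} A → AtomsBelow L A → AtomsBelow (K ⊔ L) A
AtomsBelow-⊔ʳ K A = AtomsBelow-mono A (m≤n⊔m K _)

AtomsBelow-atomBound : ∀ A → AtomsBelow (atomBound A) A
AtomsBelow-atomBound (at a)   = ≤-refl
AtomsBelow-atomBound ⊥′       = tt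
AtomsBelow-atomBound (A ∧′ B) = AtomsBelow-⊔ˡ _ A (AtomsBelow-atomBound A) , AtomsBelow-⊔ʳ _ B (AtomsBelow-atomBound B)
AtomsBelow-atomBound (A ∨′ B) = AtomsBelow-⊔ˡ _ A (AtomsBelow-atomBound A) , AtomsBelow-⊔ʳ _ B (AtomsBelow-atomBound B)
AtomsBelow-atomBound (A ⇒ B)  = AtomsBelow-⊔ˡ _ A (AtomsBelow-atomBound A) , AtomsBelow-⊔ʳ _ B (AtomsBelow-atomBound B)

freeze : ℕ → Subst
freeze K n with n <? K
... | yes _ = at (par (K + n))
... | no  _ = at (var n)

freeze-< : ∀ K {n} → n < K → freeze K n ≡ at (par (K + n))
freeze-< K {n} n<K with n <? K
... | yes _   = refl
... | no  n≮K = ⊥-elim (n≮K n<K)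

thaw : ℕ → Atom → Fm
thaw K (var n) = at (var n)
thaw K (par k) with k <? K
... | yes _ = at (par k)
... | no  _ = at (var (k ∸ K))

thaw-par-< : ∀ K {k} → k < K → thaw K (par k) ≡ at (par k)
thaw-par-< K {k} k<K with k <? K
... | yes _   = refl
... | no  k≮K = ⊥-elim (k≮K k<K)

thaw-par-fresh : ∀ K n → thaw K (par (K + n)) ≡ at (var n)
thaw-par-fresh K n with K + n <? K
... | yes K+n<K = ⊥-elim (<⇒≱ K+n<K (m≤m+n K n))
... | no  _     = cong (λ m → at (var m)) (m+n∸m≡n K n)

thaw-fixes : ∀ K A → AtomsBelow K A → A [ thaw K ] ≡ A
thaw-fixes K (at (var n)) _         = refl
thaw-fixes K (at (par k)) k<K       = thaw-par-< K k<K
thaw-fixes K ⊥′           _         = refl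
thaw-fixes K (A ∧′ B)     (bA , bB) = cong₂ _∧′_ (thaw-fixes K A bA) (thaw-fixes K B bB)
thaw-fixes K (A ∨′ B)     (bA , bB) = cong₂ _∨′_ (thaw-fixes K A bA) (thaw-fixes K B bB)
thaw-fixes K (A ⇒ B)      (bA , bB) = cong₂ _⇒_ (thaw-fixes K A bA) (thaw-fixes K B bB)

thaw-freeze : ∀ K A → AtomsBelow K A → sub (freeze K) A [ thaw K ] ≡ A
thaw-freeze K (at (var n)) n<K rewrite freeze-< K n<K = thaw-par-fresh K n
thaw-freeze K (at (par k)) k<K       = thaw-par-< K k<K
thaw-freeze K ⊥′           _         = refl
thaw-freeze K (A ∧′ B)     (bA , bB) = cong₂ _∧′_ (thaw-freeze K A bA) (thaw-freeze K B bB)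
thaw-freeze K (A ∨′ B)     (bA , bB) = cong₂ _∨′_ (thaw-freeze K A bA) (thaw-freeze K B bB)
thaw-freeze K (A ⇒ B)      (bA , bB) = cong₂ _⇒_ (thaw-freeze K A bA) (thaw-freeze K B bB)

freeze-ParFm : ∀ K A → AtomsBelow K A → ParFm (sub (freeze K) A)
freeze-ParFm K (at (var n)) n<K rewrite freeze-< K n<K = par-at (K + n)
freeze-ParFm K (at (par k)) _         = par-at k
freeze-ParFm K ⊥′           _         = par-⊥
freeze-ParFm K (A ∧′ B)     (bA , bB) = par-∧ (freeze-ParFm K A bA) (freeze-ParFm K B bB)
freeze-ParFm K (A ∨′ B)     (bA , bB) = par-∨ (freeze-ParFm K A bA) (freeze-ParFm K B bB)
freeze-ParFm K (A ⇒ B)      (bA , bB) = par-⇒ (freeze-ParFm K A bA) (freeze-ParFm K B bB)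

⊤′ : Fm
⊤′ = ⊥′ ⇒ ⊥′

link : ℕ → ℕ → Fm
link K n = at (par (K + n)) ⇔′ at (var n)

links : ℕ → ℕ → Fm
links K zero    = ⊤′
links K (suc m) = link K m ∧′ links K m

links-lookup : ∀ {Γ} K {m n} → n < m → Γ ⊢ links K m → Γ ⊢ link K n
links-lookup K {suc m} n<1+m d with m<1+n⇒m<n∨m≡n n<1+m
... | inj₁ n<m  = links-lookup K n<m (∧E₂ d)
... | inj₂ refl = ∧E₁ d

⊢-thaw-links : ∀ K m → ⊢ links K m [ thaw K ]
⊢-thaw-links K zero    = ⇒-refl ⊥′
⊢-thaw-links K (suc m) rewrite thaw-par-fresh K m = ∧I (⇔-refl (at (var m))) (⊢-thaw-links K m)

freeze-links-ParFm : ∀ K m → m ≤ K → ParFm (sub (freeze K) (links K m))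
freeze-links-ParFm K zero    _     = par-⇒ par-⊥ par-⊥
freeze-links-ParFm K (suc m) 1+m≤K rewrite freeze-< K 1+m≤K =
  par-∧ (par-∧ (par-⇒ (par-at _) (par-at _)) (par-⇒ (par-at _) (par-at _)))
        (freeze-links-ParFm K m (≤-trans (n≤1+n m) 1+m≤K))

∧-links-ParProjective : ∀ K A → AtomsBelow K A → ParProjective (A ∧′ links K K)
∧-links-ParProjective K A bA =
  sub (freeze K) F , par-∧ (freeze-ParFm K A bA) (freeze-links-ParFm K K ≤-refl) ,
  freeze K , freeze-fixed-mod-F , ⇔-refl _
  where
  F : Fm
  F = A ∧′ links K K
  freeze-fixed-mod-F : (a : Atom) → (F ∷ []) ⊢ sub (freeze K) (at a) ⇔′ at a
  freeze-fixed-mod-F (par k) = ⇔-refl _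
  freeze-fixed-mod-F (var n) with n <? K
  ... | yes n<K = links-lookup K n<K (∧E₂ (hyp (here refl)))
  ... | no  _   = ⇔-refl _

⊢⇒-|~L : ∀ {A B} → ⊢ (A ⇒ B) → A |~L B
⊢⇒-|~L A⇒B _ _ θ E⇒θA = ⇒-trans E⇒θA (⊢-sub θ A⇒B)

⊢⇒-|≈P : ∀ {A B} → ⊢ (A ⇒ B) → A |≈P B
⊢⇒-|≈P A⇒B _ _ F⇒A = ⇒-trans F⇒A A⇒B

|~L-⊢⇒ : ∀ {A B K} → AtomsBelow K A → AtomsBelow K B → A |~L B → ⊢ (A ⇒ B)
|~L-⊢⇒ {A} {B} {K} bA bB A|~B =
  ⊢-[]-closed (thaw K) frozen (cong₂ _⇒_ (thaw-freeze K A bA) (thaw-freeze K B bB))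
  where
  frozen : ⊢ (sub (freeze K) A ⇒ sub (freeze K) B)
  frozen = A|~B _ (freeze-ParFm K A bA) (freeze K) (⇒-refl _)

|≈P-⊢⇒ : ∀ {A B K} → AtomsBelow K A → AtomsBelow K B → A |≈P B → ⊢ (A ⇒ B)
|≈P-⊢⇒ {A} {B} {K} bA bB A|≈B = ∧-discharge thawed (⊢-thaw-links K K)
  where
  F⇒B : ⊢ (A ∧′ links K K ⇒ B)
  F⇒B = A|≈B _ (∧-links-ParProjective K A bA) (⇒I (∧E₁ (hyp (here refl))))
  thawed : ⊢ (A ∧′ links K K [ thaw K ] ⇒ B)
  thawed = ⊢-[]-closed (thaw K) F⇒B
             (cong₂ (λ A′ B′ → A′ ∧′ links K K [ thaw K ] ⇒ B′) (thaw-fixes K A bA) (thaw-fixes K B bB))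

corollary6p4 : (A B : Fm) →
    ((⊢ (A ⇒ B)) ⇔ (A |~L B)) × ((⊢ (A ⇒ B)) ⇔ (A |≈P B))
corollary6p4 A B =
  mk⇔ ⊢⇒-|~L (|~L-⊢⇒ bA bB) , mk⇔ ⊢⇒-|≈P (|≈P-⊢⇒ bA bB)
  where
  bA : AtomsBelow (atomBound A ⊔ atomBound B) A
  bA = AtomsBelow-⊔ˡ (atomBound B) A (AtomsBelow-atomBound A)
  bB : AtomsBelow (atomBound A ⊔ atomBound B) B
  bB = AtomsBelow-⊔ʳ (atomBound A) B (AtomsBelow-atomBound B)
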